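{- Consider the parity-check graph of a random $(d_v,d_c)$-LDPC code with block length $n$. With probability tending to $1$ as $n\to\infty$, every variable node has degree either $d_v$ or $d_v-2$ and every check node has degree either $d_c$ or $d_c-2$.
   Context: Random $(d_v,d_c)$-LDPC code: let $n$ be the block length and $m$ the number of checks, with $M := n d_v = m d_c$. Assign $d_v$ sockets to each of $n$ left (variable) vertices and $d_c$ sockets to each of $m$ right (check) vertices, numbering sockets $1,\dots,M$ on each side. Sample a uniformly random permutation $\pi$ of $\{1,\dots,M\}$ and join left socket $i$ to right socket $\pi(i)$. The parity-check graph has an edge between variable $i$ and check $j$ iff there is an odd number of socket edges between them. -}

module Defs where

open import Data.Nat using (ℕ; zero; suc; _+_; _*_; _∸_; _≡ᵇ_; NonZero)
open import Data.Nat.DivMod using (_/_; _%_)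
open import Data.Bool using (Bool; true; false; if_then_else_; _∧_; _∨_; not)
open import Data.Fin using (Fin; toℕ)
open import Data.Vec using (Vec; []; _∷_; lookup; allFin)
open import Data.List using (List; []; _∷_; concatMap; map)
open import Function using (_∘_)

insertions : ∀ {a} {A : Set a} {k : ℕ} → A → Vec A k → List (Vec A (suc k))
insertions x [] = (x ∷ []) ∷ []
insertions x (y ∷ ys) = (x ∷ y ∷ ys) ∷ map (y ∷_) (insertions x ys)

-- All orderings of a vector. perms (allFin M) lists every permutation
-- π of Fin M exactly once, as the vector (π 0, …, π (M-1)).
perms : ∀ {a} {A : Set a} {k : ℕ} → Vec A k → List (Vec A k)
perms [] = [] ∷ []
perms (x ∷ xs) = concatMap (insertions x) (perms xs)

countFin : ∀ {k : ℕ} → (Fin k → Bool) → ℕ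
countFin {zero} f = 0
countFin {suc k} f = (if f Fin.zero then 1 else 0) + countFin (f ∘ Fin.suc)

countList : ∀ {a} {A : Set a} → (A → Bool) → List A → ℕ
countList p [] = 0
countList p (x ∷ xs) = (if p x then 1 else 0) + countList p xs

allFinB : ∀ {k : ℕ} → (Fin k → Bool) → Bool
allFinB {zero} f = true
allFinB {suc k} f = f Fin.zero ∧ allFinB (f ∘ Fin.suc)

oddB : ℕ → Bool
oddB x = x % 2 ≡ᵇ 1

module LDPC (dv dc : ℕ) .{{_ : NonZero dv}} .{{_ : NonZero dc}} where

  -- Sockets are numbered 0..M-1 on each side (M = n*dv = m*dc).
  -- Left socket i belongs to variable ⌊i/dv⌋, right socket j to check ⌊j/dc⌋.
  -- π is a permutation of Fin M given as a vector; left socket i is joined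
  -- to right socket π(i).

  mult : ∀ {M : ℕ} → Vec (Fin M) M → ℕ → ℕ → ℕ
  mult π v c = countFin (λ i → ((toℕ i / dv) ≡ᵇ v) ∧ ((toℕ (lookup π i) / dc) ≡ᵇ c))

  edge : ∀ {M : ℕ} → Vec (Fin M) M → ℕ → ℕ → Bool
  edge π v c = oddB (mult π v c)

  degVar : ∀ {M n : ℕ} → (m : ℕ) → Vec (Fin M) M → Fin n → ℕ
  degVar m π v = countFin {m} (λ c → edge π (toℕ v) (toℕ c))

  degChk : ∀ {M m : ℕ} → (n : ℕ) → Vec (Fin M) M → Fin m → ℕ
  degChk n π c = countFin {n} (λ v → edge π (toℕ v) (toℕ c))

  good : (n m : ℕ) → Vec (Fin (n * dv)) (n * dv) → Bool
  good n m π =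
    allFinB {n} (λ v → (degVar m π v ≡ᵇ dv) ∨ (degVar m π v ≡ᵇ dv ∸ 2))
    ∧ allFinB {m} (λ c → (degChk n π c ≡ᵇ dc) ∨ (degChk n π c ≡ᵇ dc ∸ 2))

  badCount : (n m : ℕ) → ℕ
  badCount n m = countList (λ π → not (good n m π)) (perms (allFin (n * dv)))

-- The degree of a node counts the neighbours it meets with odd multiplicity, so it falls
-- short of its number d of sockets by 2 for each neighbour met twice, and by more for higher
-- multiplicities.  A degree outside {d, d - 2} therefore forces either three sockets of one
-- node joined to a single neighbour, or two disjoint pairs of sockets of one node, each pair
-- joined to a single neighbour.  Such a collision prescribes the values of π at r = 3 or
-- r = 4 sockets, and at most (M - r)! of the M! permutations take r prescribed values.
-- There are O(M²) prescriptions with r = 3 and O(M³) with r = 4, so the bad permutations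
-- form a fraction O(1/M) of all of them.

module Submission where

open import Defs
open import Data.Nat using (ℕ; _*_; _≤_; NonZero; _!)
open import Data.Product using (∃-syntax)
open import Relation.Binary.PropositionalEquality using (_≡_)

open import Data.Bool using (Bool; true; false; if_then_else_; _∧_; _∨_; not; T)
open import Data.Bool.Properties using (∧-assoc; ∧-comm; ∧-zeroʳ; ∨-zeroʳ; not-involutive)
open import Data.Empty using (⊥-elim)
open import Data.Fin using (Fin; toℕ) renaming (zero to fzero; suc to fsuc)
import Data.Fin.Properties as Finₚ
open import Data.List using (List; []; _∷_; _++_; map; concatMap; length)
open import Data.List.Properties using (map-∘)
open import Data.List.Membership.Propositional using (_∈_; find)
open import Data.List.Relation.Unary.All using (All; []; _∷_)
import Data.List.Relation.Unary.All as All
import Data.List.Relation.Unary.All.Properties as Allₚ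
open import Data.List.Relation.Unary.Any using (Any; here; there; any?)
open import Data.List.Relation.Unary.Unique.Propositional using (Unique; []; _∷_)
import Data.List.Relation.Unary.Unique.Propositional.Properties as Uniqueₚ
open import Data.Nat using (zero; suc; _+_; _∸_; _<_; z≤n; s≤s; _≡ᵇ_; pred; _≟_; _<?_; >-nonZero⁻¹)
open import Data.Nat.DivMod
  using (_/_; _%_; m≡m%n+[m/n]*n; m<n⇒m/n≡0; m/n≡1+[m∸n]/n; m%n<n; m<n*o⇒m/o<n; [m+n]%n≡m%n)
open import Data.Nat.Properties
open import Algebra.Properties.CommutativeSemigroup +-commutativeSemigroup using (interchange; x∙yz≈y∙xz)
open import Algebra.Properties.CommutativeSemigroup *-commutativeSemigroup
  using () renaming (x∙yz≈y∙xz to x*[y*z]≡y*[x*z])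
open import Data.Nat.Tactic.RingSolver using (solve-∀)
open import Data.List.Relation.Unary.Unique.DecPropositional _≟_ using (unique?)
open import Data.Product using (Σ; _×_; _,_; proj₁; proj₂)
open import Data.Sum using (_⊎_; inj₁; inj₂)
open import Data.Unit using (⊤; tt)
open import Data.Vec using (Vec; []; _∷_; lookup; tabulate; allFin)
open import Data.Vec.Properties using (lookup∘tabulate)
open import Data.Vec.Relation.Binary.Pointwise.Inductive using (Pointwise; []; _∷_)
open import Function using (_∘_; id)
open import Relation.Binary.PropositionalEquality
open import Relation.Nullary using (Dec; yes; no; does; _×-dec_)
open import Relation.Nullary.Decidable using (dec-true)

bit : Bool → ℕ
bit b = if b then 1 else 0

bit≤1 : ∀ b → bit b ≤ 1
bit≤1 true = s≤s z≤n
bit≤1 false = z≤n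

≡ᵇ-≡ : ∀ {m n} → (m ≡ᵇ n) ≡ true → m ≡ n
≡ᵇ-≡ {m} {n} eq = ≡ᵇ⇒≡ m n (subst T (sym eq) tt)

≡ᵇ-refl : ∀ m → (m ≡ᵇ m) ≡ true
≡ᵇ-refl zero = refl
≡ᵇ-refl (suc m) = ≡ᵇ-refl m

≡ᵇ-false-≢ : ∀ {m n} → (m ≡ᵇ n) ≡ false → m ≢ n
≡ᵇ-false-≢ {m} eq refl with trans (sym (≡ᵇ-refl m)) eq
... | ()

≢-≡ᵇ : ∀ {m n} → m ≢ n → (m ≡ᵇ n) ≡ false
≢-≡ᵇ {m} {n} m≢n with m ≡ᵇ n in eq
... | true = ⊥-elim (m≢n (≡ᵇ-≡ eq))
... | false = refl

≡ᵇ-same : ∀ {a b c} → (a ≡ᵇ c) ≡ true → (b ≡ᵇ c) ≡ true → a ≡ b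
≡ᵇ-same a≡c b≡c = trans (≡ᵇ-≡ a≡c) (sym (≡ᵇ-≡ b≡c))

≡ᵇ-either : ∀ {D d e} → D ≡ d ⊎ D ≡ e → ((D ≡ᵇ d) ∨ (D ≡ᵇ e)) ≡ true
≡ᵇ-either {D} (inj₁ refl) rewrite ≡ᵇ-refl D = refl
≡ᵇ-either {D} {d} (inj₂ refl) rewrite ≡ᵇ-refl D = ∨-zeroʳ (D ≡ᵇ d)

∧-true : ∀ {a b} → a ∧ b ≡ true → a ≡ true × b ≡ true
∧-true {true} {true} _ = refl , refl

∧-false : ∀ {a b} → a ∧ b ≡ false → a ≡ false ⊎ b ≡ false
∧-false {false} _ = inj₁ refl
∧-false {true} {false} _ = inj₂ refl

∑< : ℕ → (ℕ → ℕ) → ℕ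
∑< zero f = 0
∑< (suc K) f = f 0 + ∑< K (f ∘ suc)

∑<-cong : ∀ K {f g : ℕ → ℕ} → (∀ j → j < K → f j ≡ g j) → ∑< K f ≡ ∑< K g
∑<-cong zero e = refl
∑<-cong (suc K) e = cong₂ _+_ (e 0 (s≤s z≤n)) (∑<-cong K (λ j j<K → e (suc j) (s≤s j<K)))

∑<-mono-≤ : ∀ K {f g : ℕ → ℕ} → (∀ j → j < K → f j ≤ g j) → ∑< K f ≤ ∑< K g
∑<-mono-≤ zero e = z≤n
∑<-mono-≤ (suc K) e = +-mono-≤ (e 0 (s≤s z≤n)) (∑<-mono-≤ K (λ j j<K → e (suc j) (s≤s j<K)))

∑<-distrib-+ : ∀ K (f g : ℕ → ℕ) → ∑< K (λ j → f j + g j) ≡ ∑< K f + ∑< K g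
∑<-distrib-+ zero f g = refl
∑<-distrib-+ (suc K) f g =
  trans (cong ((f 0 + g 0) +_) (∑<-distrib-+ K (f ∘ suc) (g ∘ suc)))
        (interchange (f 0) (g 0) (∑< K (f ∘ suc)) (∑< K (g ∘ suc)))

∑<-const : ∀ K c → ∑< K (λ _ → c) ≡ K * c
∑<-const zero c = refl
∑<-const (suc K) c = cong (c +_) (∑<-const K c)

∑<-zero : ∀ K → ∑< K (λ _ → 0) ≡ 0
∑<-zero K = trans (∑<-const K 0) (*-zeroʳ K)

∑<-distribʳ-* : ∀ K (f : ℕ → ℕ) c → ∑< K (λ j → f j * c) ≡ ∑< K f * c
∑<-distribʳ-* zero f c = refl
∑<-distribʳ-* (suc K) f c =
  trans (cong (f 0 * c +_) (∑<-distribʳ-* K (f ∘ suc) c)) (sym (*-distribʳ-+ c (f 0) _))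

∑<-bound : ∀ K {f : ℕ → ℕ} {B} → (∀ j → j < K → f j ≤ B) → ∑< K f ≤ K * B
∑<-bound K {B = B} f≤B = ≤-trans (∑<-mono-≤ K f≤B) (≤-reflexive (∑<-const K B))

term≤∑< : ∀ K (f : ℕ → ℕ) {a} → a < K → f a ≤ ∑< K f
term≤∑< (suc K) f {zero} _ = m≤m+n _ _
term≤∑< (suc K) f {suc a} (s≤s a<K) = ≤-trans (term≤∑< K (f ∘ suc) a<K) (m≤n+m _ _)

∑<-+ : ∀ a b (f : ℕ → ℕ) → ∑< (a + b) f ≡ ∑< a f + ∑< b (λ j → f (a + j))
∑<-+ zero b f = refl
∑<-+ (suc a) b f = trans (cong (f 0 +_) (∑<-+ a b (f ∘ suc))) (sym (+-assoc (f 0) _ _))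

∑<-indicator : ∀ K p → p < K → ∑< K (λ j → bit (p ≡ᵇ j)) ≡ 1
∑<-indicator (suc K) zero _ = cong suc (∑<-zero K)
∑<-indicator (suc K) (suc p) (s≤s p<K) = ∑<-indicator K p p<K

∑<-indicator≤1 : ∀ K p → ∑< K (λ j → bit (p ≡ᵇ j)) ≤ 1
∑<-indicator≤1 zero p = z≤n
∑<-indicator≤1 (suc K) zero = ≤-reflexive (cong suc (∑<-zero K))
∑<-indicator≤1 (suc K) (suc p) = ∑<-indicator≤1 K p

∏ : ∀ {r} → Vec ℕ r → ℕ
∏ [] = 1
∏ (K ∷ Ks) = K * ∏ Ks

∑□ : ∀ {r} → Vec ℕ r → (Vec ℕ r → ℕ) → ℕ
∑□ [] f = f []
∑□ (K ∷ Ks) f = ∑< K (λ a → ∑□ Ks (f ∘ (a ∷_)))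

term≤∑□ : ∀ {r} (Ks : Vec ℕ r) (f : Vec ℕ r → ℕ) {is} → Pointwise _<_ is Ks → f is ≤ ∑□ Ks f
term≤∑□ [] f [] = ≤-refl
term≤∑□ (K ∷ Ks) f {a ∷ is} (a<K ∷ is<Ks) =
  ≤-trans (term≤∑□ Ks (f ∘ (a ∷_)) is<Ks) (term≤∑< K (λ a → ∑□ Ks (f ∘ (a ∷_))) a<K)

∑□-bound : ∀ {r} (Ks : Vec ℕ r) {f : Vec ℕ r → ℕ} {B} → (∀ is → f is ≤ B) → ∑□ Ks f ≤ ∏ Ks * B
∑□-bound [] {B = B} f≤B = ≤-trans (f≤B []) (≤-reflexive (sym (+-identityʳ B)))
∑□-bound (K ∷ Ks) {B = B} f≤B =
  ≤-trans (∑<-bound K (λ a _ → ∑□-bound Ks (f≤B ∘ (a ∷_)))) (≤-reflexive (sym (*-assoc K (∏ Ks) B)))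

sumMap : ∀ {a} {A : Set a} → (A → ℕ) → List A → ℕ
sumMap f [] = 0
sumMap f (x ∷ xs) = f x + sumMap f xs

sumMap-distrib-+ : ∀ {a} {A : Set a} (f g : A → ℕ) xs → sumMap (λ x → f x + g x) xs ≡ sumMap f xs + sumMap g xs
sumMap-distrib-+ f g [] = refl
sumMap-distrib-+ f g (x ∷ xs) =
  trans (cong (f x + g x +_) (sumMap-distrib-+ f g xs)) (interchange (f x) (g x) (sumMap f xs) (sumMap g xs))

sumMap-∑< : ∀ {a} {A : Set a} K (g : A → ℕ → ℕ) xs →
  sumMap (λ x → ∑< K (g x)) xs ≡ ∑< K (λ j → sumMap (λ x → g x j) xs)
sumMap-∑< K g [] = sym (∑<-zero K)
sumMap-∑< K g (x ∷ xs) =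
  trans (cong (∑< K (g x) +_) (sumMap-∑< K g xs)) (sym (∑<-distrib-+ K (g x) (λ j → sumMap (λ y → g y j) xs)))

sumMap-∑□ : ∀ {a} {A : Set a} {r} (Ks : Vec ℕ r) (g : A → Vec ℕ r → ℕ) xs →
  sumMap (λ x → ∑□ Ks (g x)) xs ≡ ∑□ Ks (λ is → sumMap (λ x → g x is) xs)
sumMap-∑□ [] g xs = refl
sumMap-∑□ (K ∷ Ks) g xs =
  trans (sumMap-∑< K (λ x a → ∑□ Ks (g x ∘ (a ∷_))) xs)
        (∑<-cong K (λ a _ → sumMap-∑□ Ks (λ x → g x ∘ (a ∷_)) xs))

countFin-cong : ∀ {K} {f g : Fin K → Bool} → (∀ i → f i ≡ g i) → countFin f ≡ countFin g
countFin-cong {zero} e = refl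
countFin-cong {suc K} e = cong₂ _+_ (cong bit (e fzero)) (countFin-cong (e ∘ fsuc))

countFin-false : ∀ K → countFin {K} (λ _ → false) ≡ 0
countFin-false zero = refl
countFin-false (suc K) = countFin-false K

countFin-∑< : ∀ K (h : ℕ → Bool) → countFin {K} (h ∘ toℕ) ≡ ∑< K (bit ∘ h)
countFin-∑< zero h = refl
countFin-∑< (suc K) h = cong (bit (h 0) +_) (countFin-∑< K (h ∘ suc))

countFin-≥1 : ∀ {K} (p : Fin K → Bool) → 1 ≤ countFin p → Σ (Fin K) λ i → p i ≡ true
countFin-≥1 {suc K} p 1≤count with p fzero in p₀
... | true = fzero , p₀
... | false with countFin-≥1 (p ∘ fsuc) 1≤count
...   | i , pᵢ = fsuc i , pᵢ

countFin-≥2 : ∀ {K} (p : Fin K → Bool) → 2 ≤ countFin p →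
  Σ (Fin K) λ i → Σ (Fin K) λ j → i ≢ j × p i ≡ true × p j ≡ true
countFin-≥2 {suc K} p 2≤count with p fzero in p₀
... | true with countFin-≥1 (p ∘ fsuc) (≤-pred 2≤count)
...   | j , pⱼ = fzero , fsuc j , (λ ()) , p₀ , pⱼ
countFin-≥2 {suc K} p 2≤count | false with countFin-≥2 (p ∘ fsuc) 2≤count
...   | i , j , i≢j , pᵢ , pⱼ = fsuc i , fsuc j , i≢j ∘ Finₚ.suc-injective , pᵢ , pⱼ

allFinB-false : ∀ {K} (f : Fin K → Bool) → allFinB f ≡ false → Σ (Fin K) λ i → f i ≡ false
allFinB-false {suc K} f all≡false with f fzero in f₀
... | false = fzero , f₀
... | true with allFinB-false (f ∘ fsuc) all≡false
...   | i , fᵢ = fsuc i , fᵢ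

countList-++ : ∀ {a} {A : Set a} (p : A → Bool) xs ys →
  countList p (xs ++ ys) ≡ countList p xs + countList p ys
countList-++ p [] ys = refl
countList-++ p (x ∷ xs) ys = trans (cong (bit (p x) +_) (countList-++ p xs ys)) (sym (+-assoc (bit (p x)) _ _))

countList-map : ∀ {a b} {A : Set a} {B : Set b} (p : B → Bool) (g : A → B) xs →
  countList p (map g xs) ≡ countList (p ∘ g) xs
countList-map p g [] = refl
countList-map p g (x ∷ xs) = cong (bit (p (g x)) +_) (countList-map p g xs)

countList-cong : ∀ {a} {A : Set a} {p q : A → Bool} xs → (∀ x → p x ≡ q x) → countList p xs ≡ countList q xs
countList-cong [] e = refl
countList-cong (x ∷ xs) e = cong₂ _+_ (cong bit (e x)) (countList-cong xs e)

countList-∧ˡ : ∀ {A : Set} b (P : A → Bool) L → countList (λ a → b ∧ P a) L ≡ bit b * countList P L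
countList-∧ˡ true P L = sym (+-identityʳ _)
countList-∧ˡ false P [] = refl
countList-∧ˡ false P (a ∷ L) = countList-∧ˡ false P L

countList-false : ∀ {A : Set} {P : A → Bool} {Q : A → Set} L → All Q L → (∀ {a} → Q a → P a ≡ false) →
  countList P L ≡ 0
countList-false [] [] _ = refl
countList-false (a ∷ L) (q ∷ qs) P-false rewrite P-false q = countList-false L qs P-false

countList≤sumMap : ∀ {a} {A : Set a} {Q : A → Set} (P : A → Bool) (f : A → ℕ) {xs} → All Q xs →
  (∀ {x} → Q x → bit (P x) ≤ f x) → countList P xs ≤ sumMap f xs
countList≤sumMap P f [] _ = z≤n
countList≤sumMap P f (q ∷ qs) P≤f = +-mono-≤ (P≤f q) (countList≤sumMap P f qs P≤f)

sumMap-bit : ∀ {a} {A : Set a} (P : A → Bool) xs → sumMap (bit ∘ P) xs ≡ countList P xs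
sumMap-bit P [] = refl
sumMap-bit P (x ∷ xs) = cong (bit (P x) +_) (sumMap-bit P xs)

!-mono-≤ : ∀ {m n} → m ≤ n → m ! ≤ n !
!-mono-≤ {zero} {n} _ = 1≤n! n
!-mono-≤ {suc m} {suc n} (s≤s m≤n) = *-mono-≤ (s≤s m≤n) (!-mono-≤ m≤n)

[1+a∸r]*[a∸r]!≤[1+a∸r]! : ∀ a r → (suc a ∸ r) * (a ∸ r) ! ≤ (suc a ∸ r) !
[1+a∸r]*[a∸r]!≤[1+a∸r]! a zero = ≤-refl
[1+a∸r]*[a∸r]!≤[1+a∸r]! zero (suc r) rewrite 0∸n≡0 r = z≤n
[1+a∸r]*[a∸r]!≤[1+a∸r]! (suc a) (suc r) = [1+a∸r]*[a∸r]!≤[1+a∸r]! a r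

insertAtℕ : ∀ {A : Set} {k} → ℕ → A → Vec A k → Vec A (suc k)
insertAtℕ zero x ys = x ∷ ys
insertAtℕ (suc j) x [] = x ∷ []
insertAtℕ (suc j) x (y ∷ ys) = y ∷ insertAtℕ j x ys

countList-insertions : ∀ {A : Set} {k} (P : Vec A (suc k) → Bool) x (σ : Vec A k) →
  countList P (insertions x σ) ≡ ∑< (suc k) (λ j → bit (P (insertAtℕ j x σ)))
countList-insertions P x [] = refl
countList-insertions P x (y ∷ ys) = cong (bit (P (x ∷ y ∷ ys)) +_)
  (trans (countList-map P (y ∷_) (insertions x ys)) (countList-insertions (P ∘ (y ∷_)) x ys))

countList-perms-∷ : ∀ {A : Set} {k} (P : Vec A (suc k) → Bool) x (xs : Vec A k) →
  countList P (perms (x ∷ xs)) ≡ ∑< (suc k) (λ j → countList (P ∘ insertAtℕ j x) (perms xs))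
countList-perms-∷ {k = k} P x xs = go (perms xs)
  where
  go : ∀ L → countList P (concatMap (insertions x) L) ≡ ∑< (suc k) (λ j → countList (P ∘ insertAtℕ j x) L)
  go [] = sym (∑<-zero (suc k))
  go (σ ∷ L) = begin
    countList P (insertions x σ ++ concatMap (insertions x) L)
      ≡⟨ countList-++ P (insertions x σ) _ ⟩
    countList P (insertions x σ) + countList P (concatMap (insertions x) L)
      ≡⟨ cong₂ _+_ (countList-insertions P x σ) (go L) ⟩
    ∑< (suc k) (λ j → bit (P (insertAtℕ j x σ))) + ∑< (suc k) (λ j → countList (P ∘ insertAtℕ j x) L)
      ≡⟨ sym (∑<-distrib-+ (suc k) (λ j → bit (P (insertAtℕ j x σ))) (λ j → countList (P ∘ insertAtℕ j x) L)) ⟩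
    ∑< (suc k) (λ j → countList (P ∘ insertAtℕ j x) (σ ∷ L)) ∎
    where open ≡-Reasoning

All-insertions : ∀ {A : Set} {k} (Q : Vec A (suc k) → Set) x (σ : Vec A k) →
  (∀ j → j ≤ k → Q (insertAtℕ j x σ)) → All Q (insertions x σ)
All-insertions Q x [] h = h 0 z≤n ∷ []
All-insertions Q x (y ∷ ys) h =
  h 0 z≤n ∷ Allₚ.map⁺ (All-insertions (Q ∘ (y ∷_)) x ys (λ j j≤k → h (suc j) (s≤s j≤k)))

All-concatMap : ∀ {A B : Set} {Q : B → Set} (f : A → List B) L → All (All Q ∘ f) L → All Q (concatMap f L)
All-concatMap f [] [] = []
All-concatMap f (a ∷ L) (q ∷ qs) = Allₚ.++⁺ q (All-concatMap f L qs)

All-perms : ∀ {A : Set} (Inv : ∀ {k} → Vec A k → Vec A k → Set) → Inv [] [] →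
  (∀ {k} (σ xs : Vec A k) x j → j ≤ k → Inv σ xs → Inv (insertAtℕ j x σ) (x ∷ xs)) →
  ∀ {k} (xs : Vec A k) → All (λ σ → Inv σ xs) (perms xs)
All-perms Inv base step [] = base ∷ []
All-perms Inv base step (x ∷ xs) =
  All-concatMap (insertions x) (perms xs)
    (All.map (λ {σ} inv → All-insertions _ x σ (λ j j≤k → step σ xs x j j≤k inv)) (All-perms Inv base step xs))

countFin-insertAtℕ : ∀ {A : Set} {k} (g : A → Bool) j x (σ : Vec A k) → j ≤ k →
  countFin (g ∘ lookup (insertAtℕ j x σ)) ≡ bit (g x) + countFin (g ∘ lookup σ)
countFin-insertAtℕ g zero x σ _ = refl
countFin-insertAtℕ g (suc j) x (y ∷ σ) (s≤s j≤k) =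
  trans (cong (bit (g y) +_) (countFin-insertAtℕ g j x σ j≤k)) (x∙yz≈y∙xz (bit (g y)) (bit (g x)) _)

countFin-lookup-perms : ∀ {A : Set} {k} (xs : Vec A k) →
  All (λ σ → ∀ g → countFin (g ∘ lookup σ) ≡ countFin (g ∘ lookup xs)) (perms xs)
countFin-lookup-perms = All-perms (λ σ xs → ∀ g → countFin (g ∘ lookup σ) ≡ countFin (g ∘ lookup xs)) (λ g → refl)
  (λ σ xs x j j≤k same g → trans (countFin-insertAtℕ g j x σ j≤k) (cong (bit (g x) +_) (same g)))

countFin-lookup-allFin : ∀ M (g : Fin M → Bool) → countFin (g ∘ lookup (allFin M)) ≡ countFin g
countFin-lookup-allFin M g = countFin-cong (λ i → cong g (lookup∘tabulate id i))

-- The index of position p once position j is removed, as Fin.punchOut (junk value at p = j).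
punchOutℕ : ℕ → ℕ → ℕ
punchOutℕ zero p = pred p
punchOutℕ (suc j) zero = zero
punchOutℕ (suc j) (suc p) = suc (punchOutℕ j p)

punchOutℕ-injective : ∀ {j p q} → p ≢ j → q ≢ j → punchOutℕ j p ≡ punchOutℕ j q → p ≡ q
punchOutℕ-injective {zero} {zero} p≢j _ _ = ⊥-elim (p≢j refl)
punchOutℕ-injective {zero} {suc p} {zero} _ q≢j _ = ⊥-elim (q≢j refl)
punchOutℕ-injective {zero} {suc p} {suc q} _ _ eq = cong suc eq
punchOutℕ-injective {suc j} {zero} {zero} _ _ _ = refl
punchOutℕ-injective {suc j} {suc p} {suc q} p≢j q≢j eq =
  cong suc (punchOutℕ-injective (p≢j ∘ cong suc) (q≢j ∘ cong suc) (suc-injective eq))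

punchOutℕ-< : ∀ {k j p} → j ≤ k → p < suc k → p ≢ j → punchOutℕ j p < k
punchOutℕ-< {j = zero} {zero} _ _ p≢j = ⊥-elim (p≢j refl)
punchOutℕ-< {j = zero} {suc p} _ (s≤s p<k) _ = p<k
punchOutℕ-< {suc k} {suc j} {zero} _ _ _ = s≤s z≤n
punchOutℕ-< {suc k} {suc j} {suc p} (s≤s j≤k) (s≤s p<k) p≢j = s≤s (punchOutℕ-< j≤k p<k (p≢j ∘ cong suc))

-- A prescription is a list of (position, key) pairs that a vector has to match.
Prescription : Set
Prescription = List (ℕ × ℕ)

positions : Prescription → List ℕ
positions = map proj₁

restrict : ℕ → Prescription → Prescription
restrict j [] = []
restrict j ((p , u) ∷ cs) = if p ≡ᵇ j then restrict j cs else (punchOutℕ j p , u) ∷ restrict j cs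

agreesAt : ℕ → ℕ → Prescription → Bool
agreesAt j v [] = true
agreesAt j v ((p , u) ∷ cs) = (if p ≡ᵇ j then v ≡ᵇ u else true) ∧ agreesAt j v cs

free : ℕ → Prescription → Bool
free j [] = true
free j ((p , u) ∷ cs) = not (p ≡ᵇ j) ∧ free j cs

Valid : ℕ → Prescription → Set
Valid k cs = All (_< k) (positions cs) × Unique (positions cs)

valid? : ∀ k cs → Dec (Valid k cs)
valid? k cs = All.all? (_<? k) (positions cs) ×-dec unique? (positions cs)

All-restrict : ∀ {P Q : ℕ → Set} j cs → (∀ {q} → q ≢ j → P q → Q (punchOutℕ j q)) →
  All P (positions cs) → All Q (positions (restrict j cs))
All-restrict j [] f [] = []
All-restrict j ((p , u) ∷ cs) f (Pp ∷ Pcs) with p ≡ᵇ j in p≟j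
... | true = All-restrict j cs f Pcs
... | false = f (≡ᵇ-false-≢ p≟j) Pp ∷ All-restrict j cs f Pcs

Unique-restrict : ∀ j cs → Unique (positions cs) → Unique (positions (restrict j cs))
Unique-restrict j [] [] = []
Unique-restrict j ((p , u) ∷ cs) (p∉cs ∷ unique) with p ≡ᵇ j in p≟j
... | true = Unique-restrict j cs unique
... | false = All-restrict j cs (λ q≢j p≢q → p≢q ∘ punchOutℕ-injective (≡ᵇ-false-≢ p≟j) q≢j) p∉cs
            ∷ Unique-restrict j cs unique

restrict-valid : ∀ {k j} cs → j ≤ k → Valid (suc k) cs → Valid k (restrict j cs)
restrict-valid {j = j} cs j≤k (bounded , unique) =
  All-restrict j cs (λ q≢j q<1+k → punchOutℕ-< j≤k q<1+k q≢j) bounded , Unique-restrict j cs unique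

free-∉ : ∀ {j} cs → All (j ≢_) (positions cs) → free j cs ≡ true
free-∉ [] [] = refl
free-∉ {j} ((p , u) ∷ cs) (j≢p ∷ j∉cs)
  rewrite ≢-≡ᵇ (j≢p ∘ sym) = free-∉ cs j∉cs

length-restrict-free : ∀ j cs → free j cs ≡ true → length (restrict j cs) ≡ length cs
length-restrict-free j [] _ = refl
length-restrict-free j ((p , u) ∷ cs) j-free with p ≡ᵇ j
... | false = cong suc (length-restrict-free j cs j-free)

length-restrict : ∀ j cs → Unique (positions cs) → length cs ≤ suc (length (restrict j cs))
length-restrict j [] [] = z≤n
length-restrict j ((p , u) ∷ cs) (p∉cs ∷ unique) with p ≡ᵇ j in p≟j
... | true = s≤s (≤-reflexive (sym (length-restrict-free j cs
               (free-∉ cs (subst (λ q → All (q ≢_) (positions cs)) (≡ᵇ-≡ p≟j) p∉cs)))))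
... | false = s≤s (length-restrict j cs unique)

bit-free-∷ : ∀ p u cs j → free p cs ≡ true →
  bit (free j cs) ≡ bit (free j ((p , u) ∷ cs)) + bit (p ≡ᵇ j)
bit-free-∷ p u cs j p-free with p ≡ᵇ j in p≟j
... | true with refl ← ≡ᵇ-≡ {p} {j} p≟j rewrite p-free = refl
... | false = sym (+-identityʳ _)

∑<-free : ∀ K cs → Valid K cs → ∑< K (λ j → bit (free j cs)) + length cs ≡ K
∑<-free K [] _ = trans (+-identityʳ _) (trans (∑<-const K 1) (*-identityʳ K))
∑<-free K ((p , u) ∷ cs) (p<K ∷ bounded , p∉cs ∷ unique) = begin
  ∑< K (λ j → bit (free j ((p , u) ∷ cs))) + suc (length cs)
    ≡⟨ +-suc _ (length cs) ⟩
  suc (∑< K (λ j → bit (free j ((p , u) ∷ cs)))) + length cs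
    ≡⟨ cong (λ n → n + length cs) (trans (+-comm 1 Σfree) (cong (Σfree +_) (sym (∑<-indicator K p p<K)))) ⟩
  (∑< K (λ j → bit (free j ((p , u) ∷ cs))) + ∑< K (λ j → bit (p ≡ᵇ j))) + length cs
    ≡⟨ cong (_+ length cs) (sym (∑<-distrib-+ K _ _)) ⟩
  ∑< K (λ j → bit (free j ((p , u) ∷ cs)) + bit (p ≡ᵇ j)) + length cs
    ≡⟨ cong (_+ length cs) (∑<-cong K (λ j _ → sym (bit-free-∷ p u cs j (free-∉ cs p∉cs)))) ⟩
  ∑< K (λ j → bit (free j cs)) + length cs
    ≡⟨ ∑<-free K cs (bounded , unique) ⟩
  K ∎
  where
  open ≡-Reasoning
  Σfree = ∑< K (λ j → bit (free j ((p , u) ∷ cs)))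

module KeyedVectors {A : Set} (κ : A → ℕ) where

  hasKeyAt : ∀ {k} → Vec A k → ℕ → ℕ → Bool
  hasKeyAt [] p v = false
  hasKeyAt (y ∷ ys) zero v = κ y ≡ᵇ v
  hasKeyAt (y ∷ ys) (suc p) v = hasKeyAt ys p v

  satisfies : ∀ {k} → Prescription → Vec A k → Bool
  satisfies [] σ = true
  satisfies ((p , u) ∷ cs) σ = hasKeyAt σ p u ∧ satisfies cs σ

  KeyAbsent : ∀ {k} → ℕ → Vec A k → Set
  KeyAbsent v σ = ∀ p → hasKeyAt σ p v ≡ false

  Distinct : ∀ {k} → Vec A k → Set
  Distinct [] = ⊤
  Distinct (x ∷ xs) = KeyAbsent (κ x) xs × Distinct xs

  hasKeyAt-insertAtℕ : ∀ {k} j x (σ : Vec A k) p v → j ≤ k →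
    hasKeyAt (insertAtℕ j x σ) p v ≡ (if p ≡ᵇ j then κ x ≡ᵇ v else hasKeyAt σ (punchOutℕ j p) v)
  hasKeyAt-insertAtℕ zero x σ zero v _ = refl
  hasKeyAt-insertAtℕ zero x σ (suc p) v _ = refl
  hasKeyAt-insertAtℕ (suc j) x (y ∷ σ) zero v _ = refl
  hasKeyAt-insertAtℕ (suc j) x (y ∷ σ) (suc p) v (s≤s j≤k) = hasKeyAt-insertAtℕ j x σ p v j≤k

  satisfies-insertAtℕ : ∀ {k} j x (σ : Vec A k) cs → j ≤ k →
    satisfies cs (insertAtℕ j x σ) ≡ agreesAt j (κ x) cs ∧ satisfies (restrict j cs) σ
  satisfies-insertAtℕ j x σ [] _ = refl
  satisfies-insertAtℕ j x σ ((p , u) ∷ cs) j≤k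
    rewrite hasKeyAt-insertAtℕ j x σ p u j≤k | satisfies-insertAtℕ j x σ cs j≤k with p ≡ᵇ j
  ... | true = sym (∧-assoc (κ x ≡ᵇ u) _ _)
  ... | false with hasKeyAt σ (punchOutℕ j p) u
  ...   | true = refl
  ...   | false = sym (∧-zeroʳ (agreesAt j (κ x) cs))

  KeyAbsent-perms : ∀ v {k} (xs : Vec A k) → KeyAbsent v xs → All (KeyAbsent v) (perms xs)
  KeyAbsent-perms v xs v∉xs = All.map (λ inherit → inherit v∉xs)
    (All-perms (λ σ ys → KeyAbsent v ys → KeyAbsent v σ) (λ v∉[] → v∉[]) step xs)
    where
    step : ∀ {k} (σ ys : Vec A k) y j → j ≤ k → (KeyAbsent v ys → KeyAbsent v σ) →
      KeyAbsent v (y ∷ ys) → KeyAbsent v (insertAtℕ j y σ)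
    step σ ys y j j≤k inherit v∉y∷ys p rewrite hasKeyAt-insertAtℕ j y σ p v j≤k with p ≡ᵇ j
    ... | true = v∉y∷ys 0
    ... | false = inherit (v∉y∷ys ∘ suc) (punchOutℕ j p)

  hasKeyAt-lookup : ∀ {k} (σ : Vec A k) i → hasKeyAt σ (toℕ i) (κ (lookup σ i)) ≡ true
  hasKeyAt-lookup (y ∷ σ) fzero = ≡ᵇ-refl (κ y)
  hasKeyAt-lookup (y ∷ σ) (fsuc i) = hasKeyAt-lookup σ i

  Distinct-tabulate : ∀ {k} (g : Fin k → A) → (∀ {i j} → κ (g i) ≡ κ (g j) → i ≡ j) → Distinct (tabulate g)
  Distinct-tabulate {zero} g _ = tt
  Distinct-tabulate {suc k} g κ∘g-injective =
    absent (g ∘ fsuc) (λ i → Finₚ.0≢1+n ∘ κ∘g-injective) ,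
    Distinct-tabulate (g ∘ fsuc) (Finₚ.suc-injective ∘ κ∘g-injective)
    where
    absent : ∀ {k} (h : Fin k → A) → (∀ i → κ (g fzero) ≢ κ (h i)) → KeyAbsent (κ (g fzero)) (tabulate h)
    absent {zero} h _ p = refl
    absent {suc k} h g₀∉h zero = ≢-≡ᵇ (g₀∉h fzero ∘ sym)
    absent {suc k} h g₀∉h (suc p) = absent (h ∘ fsuc) (g₀∉h ∘ fsuc) p

  satisfies-KeyAbsent : ∀ {k} {p v} cs (σ : Vec A k) → (p , v) ∈ cs → KeyAbsent v σ → satisfies cs σ ≡ false
  satisfies-KeyAbsent {p = p} (_ ∷ cs) σ (here refl) v∉σ rewrite v∉σ p = refl
  satisfies-KeyAbsent ((q , u) ∷ cs) σ (there pv∈cs) v∉σ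
    rewrite satisfies-KeyAbsent cs σ pv∈cs v∉σ = ∧-zeroʳ (hasKeyAt σ q u)

  ∈-restrict : ∀ {j p v} cs → (p , v) ∈ cs → p ≢ j → (punchOutℕ j p , v) ∈ restrict j cs
  ∈-restrict {j} ((q , u) ∷ cs) (here refl) p≢j rewrite ≢-≡ᵇ p≢j = here refl
  ∈-restrict {j} ((q , u) ∷ cs) (there pv∈cs) p≢j with q ≡ᵇ j
  ... | true = ∈-restrict cs pv∈cs p≢j
  ... | false = there (∈-restrict cs pv∈cs p≢j)

  agreesAt-unprescribed : ∀ j v cs → All (λ c → proj₂ c ≢ v) cs → agreesAt j v cs ≡ free j cs
  agreesAt-unprescribed j v [] [] = refl
  agreesAt-unprescribed j v ((p , u) ∷ cs) (u≢v ∷ rest) with p ≡ᵇ j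
  ... | true rewrite ≢-≡ᵇ (u≢v ∘ sym) = refl
  ... | false = agreesAt-unprescribed j v cs rest

  module Placements {k} (x : A) (xs : Vec A k) (x∉xs : KeyAbsent (κ x) xs) (cs : Prescription)
                    (valid : Valid (suc k) cs) where

    private
      r = length cs
      n : ℕ → ℕ
      n j = countList (satisfies (restrict j cs)) (perms xs)

    placements-unprescribed : All (λ c → proj₂ c ≢ κ x) cs →
      (∀ j → j ≤ k → n j ≤ (k ∸ length (restrict j cs)) !) →
      ∑< (suc k) (λ j → bit (agreesAt j (κ x) cs) * n j) ≤ (suc k ∸ r) !
    placements-unprescribed unprescribed IH = begin
      ∑< (suc k) (λ j → bit (agreesAt j (κ x) cs) * n j)  ≤⟨ ∑<-mono-≤ (suc k) term-bound ⟩
      ∑< (suc k) (λ j → bit (free j cs) * (k ∸ r) !)     ≡⟨ ∑<-distribʳ-* (suc k) (λ j → bit (free j cs)) _ ⟩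
      ∑< (suc k) (λ j → bit (free j cs)) * (k ∸ r) !     ≡⟨ cong (_* (k ∸ r) !) free-count ⟩
      (suc k ∸ r) * (k ∸ r) !                            ≤⟨ [1+a∸r]*[a∸r]!≤[1+a∸r]! k r ⟩
      (suc k ∸ r) ! ∎
      where
      open ≤-Reasoning
      free-count : ∑< (suc k) (λ j → bit (free j cs)) ≡ suc k ∸ r
      free-count = trans (sym (m+n∸n≡m _ r)) (cong (_∸ r) (∑<-free (suc k) cs valid))
      term-bound : ∀ j → j < suc k → bit (agreesAt j (κ x) cs) * n j ≤ bit (free j cs) * (k ∸ r) !
      term-bound j j<1+k rewrite agreesAt-unprescribed j (κ x) cs unprescribed with free j cs in j-free
      ... | true =
        *-monoʳ-≤ 1 (subst (λ l → n j ≤ (k ∸ l) !) (length-restrict-free j cs j-free) (IH j (≤-pred j<1+k)))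
      ... | false = z≤n

    placements-prescribed : ∀ {p} → (p , κ x) ∈ cs →
      (∀ j → j ≤ k → n j ≤ (k ∸ length (restrict j cs)) !) →
      ∑< (suc k) (λ j → bit (agreesAt j (κ x) cs) * n j) ≤ (suc k ∸ r) !
    placements-prescribed {p} pκx∈cs IH = begin
      ∑< (suc k) (λ j → bit (agreesAt j (κ x) cs) * n j)  ≤⟨ ∑<-mono-≤ (suc k) term-bound ⟩
      ∑< (suc k) (λ j → bit (p ≡ᵇ j) * (suc k ∸ r) !)    ≡⟨ ∑<-distribʳ-* (suc k) (λ j → bit (p ≡ᵇ j)) _ ⟩
      ∑< (suc k) (λ j → bit (p ≡ᵇ j)) * (suc k ∸ r) !    ≤⟨ *-monoˡ-≤ _ (∑<-indicator≤1 (suc k) p) ⟩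
      1 * (suc k ∸ r) !                                  ≡⟨ *-identityˡ _ ⟩
      (suc k ∸ r) ! ∎
      where
      open ≤-Reasoning
      term-bound : ∀ j → j < suc k → bit (agreesAt j (κ x) cs) * n j ≤ bit (p ≡ᵇ j) * (suc k ∸ r) !
      term-bound j j<1+k with p ≡ᵇ j in p≟j
      ... | true = begin
        bit (agreesAt j (κ x) cs) * n j    ≤⟨ *-monoˡ-≤ (n j) (bit≤1 (agreesAt j (κ x) cs)) ⟩
        1 * n j                           ≡⟨ *-identityˡ (n j) ⟩
        n j                               ≤⟨ IH j (≤-pred j<1+k) ⟩
        (k ∸ length (restrict j cs)) !    ≤⟨ !-mono-≤ (∸-monoʳ-≤ (suc k) (length-restrict j cs (proj₂ valid))) ⟩
        (suc k ∸ r) !                     ≡⟨ sym (*-identityˡ _) ⟩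
        1 * (suc k ∸ r) ! ∎
      ... | false = ≤-reflexive (trans (cong (bit (agreesAt j (κ x) cs) *_) no-completion)
                                       (*-zeroʳ (bit (agreesAt j (κ x) cs))))
        where
        no-completion : n j ≡ 0
        no-completion = countList-false (perms xs) (KeyAbsent-perms (κ x) xs x∉xs)
          (λ {σ} → satisfies-KeyAbsent (restrict j cs) σ (∈-restrict cs pκx∈cs (≡ᵇ-false-≢ p≟j)))

  -- Induct on the vector: the first element x is inserted at some position j of a
  -- permutation of the rest. If some prescription asks for the key of x, only its own
  -- position j can work, since the rest lacks that key; otherwise only the free positions can.
  countList-satisfies : ∀ {k} (xs : Vec A k) → Distinct xs → ∀ cs → Valid k cs →
    countList (satisfies cs) (perms xs) ≤ (k ∸ length cs) !
  countList-satisfies [] _ cs _ rewrite 0∸n≡0 (length cs) | +-identityʳ (bit (satisfies cs [])) =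
    bit≤1 (satisfies cs [])
  countList-satisfies {suc k} (x ∷ xs) (x∉xs , distinct) cs valid = begin
    countList (satisfies cs) (perms (x ∷ xs))
      ≡⟨ countList-perms-∷ (satisfies cs) x xs ⟩
    ∑< (suc k) (λ j → countList (satisfies cs ∘ insertAtℕ j x) (perms xs))
      ≡⟨ ∑<-cong (suc k) (λ j j<1+k →
           trans (countList-cong (perms xs) (λ σ → satisfies-insertAtℕ j x σ cs (≤-pred j<1+k)))
                 (countList-∧ˡ (agreesAt j (κ x) cs) _ (perms xs))) ⟩
    ∑< (suc k) (λ j → bit (agreesAt j (κ x) cs) * countList (satisfies (restrict j cs)) (perms xs))
      ≤⟨ placements (any? (λ c → proj₂ c ≟ κ x) cs) ⟩
    (suc k ∸ length cs) ! ∎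
    where
    open ≤-Reasoning
    open Placements x xs x∉xs cs valid
    IH : ∀ j → j ≤ k → countList (satisfies (restrict j cs)) (perms xs) ≤ (k ∸ length (restrict j cs)) !
    IH j j≤k = countList-satisfies xs distinct (restrict j cs) (restrict-valid cs j≤k valid)
    placements : Dec (Any (λ c → proj₂ c ≡ κ x) cs) → _
    placements (no unprescribed) = placements-unprescribed (Allₚ.¬Any⇒All¬ cs unprescribed) IH
    placements (yes prescribed) with find prescribed
    ... | _ , pκx∈cs , refl = placements-prescribed pκx∈cs IH

oddB-suc : ∀ x → oddB (suc x) ≡ not (oddB x)
oddB-suc zero = refl
oddB-suc (suc x) = begin
  oddB (2 + x)          ≡⟨ cong (_≡ᵇ 1) (trans (cong (_% 2) (+-comm 2 x)) ([m+n]%n≡m%n x 2)) ⟩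
  oddB x                ≡⟨ sym (not-involutive (oddB x)) ⟩
  not (not (oddB x))    ≡⟨ cong not (sym (oddB-suc x)) ⟩
  not (oddB (suc x))    ∎
  where open ≡-Reasoning

-- Adding one to the value G c₀ flips the parity at c₀ only.
countFin-oddB-bump : ∀ m c₀ (G : ℕ → ℕ) → c₀ < m →
  countFin {m} (λ c → oddB (bit (c₀ ≡ᵇ toℕ c) + G (toℕ c))) + bit (oddB (G c₀))
    ≡ countFin {m} (λ c → oddB (G (toℕ c))) + bit (not (oddB (G c₀)))
countFin-oddB-bump (suc m) zero G _ rewrite oddB-suc (G 0) with oddB (G 0)
... | true = trans (+-comm R 1) (sym (+-identityʳ (suc R)))
  where R = countFin {m} (λ c → oddB (G (suc (toℕ c))))
... | false = trans (+-identityʳ (suc R)) (+-comm 1 R)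
  where R = countFin {m} (λ c → oddB (G (suc (toℕ c))))
countFin-oddB-bump (suc m) (suc c₀) G (s≤s c₀<m) = begin
  (bit (oddB (G 0)) + New) + bit (oddB (G (suc c₀)))   ≡⟨ +-assoc (bit (oddB (G 0))) New _ ⟩
  bit (oddB (G 0)) + (New + bit (oddB (G (suc c₀))))
    ≡⟨ cong (bit (oddB (G 0)) +_) (countFin-oddB-bump m c₀ (G ∘ suc) c₀<m) ⟩
  bit (oddB (G 0)) + (Old + bit (not (oddB (G (suc c₀))))) ≡⟨ sym (+-assoc (bit (oddB (G 0))) Old _) ⟩
  (bit (oddB (G 0)) + Old) + bit (not (oddB (G (suc c₀)))) ∎
  where
  open ≡-Reasoning
  New = countFin {m} (λ c → oddB (bit (c₀ ≡ᵇ toℕ c) + G (suc (toℕ c))))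
  Old = countFin {m} (λ c → oddB (G (suc (toℕ c))))

-- A node whose sockets are selected by s, the socket i being joined to the node f i on the other side.
module _ {K : ℕ} (s : Fin K → Bool) (f : Fin K → ℕ) where

  multiplicity : ℕ → ℕ
  multiplicity c = countFin (λ i → s i ∧ (f i ≡ᵇ c))

  oddDegree : ℕ → ℕ
  oddDegree m = countFin {m} (λ c → oddB (multiplicity (toℕ c)))

  record Pair : Set where
    constructor pair
    field
      {i j} : Fin K
      i≢j : i ≢ j
      sel-i : s i ≡ true
      sel-j : s j ≡ true
      f-ij : f i ≡ f j

  record Triple : Set where
    constructor triple
    field
      {i j l} : Fin K
      i≢j : i ≢ j
      i≢l : i ≢ l
      j≢l : j ≢ l
      sel-i : s i ≡ true
      sel-j : s j ≡ true
      sel-l : s l ≡ true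
      f-ij : f i ≡ f j
      f-il : f i ≡ f l

  record TwoPairs : Set where
    constructor twoPairs
    field
      {i j l o} : Fin K
      i≢j : i ≢ j
      i≢l : i ≢ l
      i≢o : i ≢ o
      j≢l : j ≢ l
      j≢o : j ≢ o
      l≢o : l ≢ o
      sel-i : s i ≡ true
      sel-j : s j ≡ true
      sel-l : s l ≡ true
      sel-o : s o ≡ true
      f-ij : f i ≡ f j
      f-lo : f l ≡ f o

  data DegreeView (m : ℕ) : Set where
    hasTriple   : Triple → DegreeView m
    hasTwoPairs : TwoPairs → DegreeView m
    noPair      : oddDegree m ≡ countFin s → DegreeView m
    onePair     : Pair → oddDegree m + 2 ≡ countFin s → DegreeView m

module _ {K : ℕ} {s : Fin (suc K) → Bool} {f : Fin (suc K) → ℕ} where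

  private
    fsuc-≢ : ∀ {a b : Fin K} → a ≢ b → fsuc a ≢ fsuc b
    fsuc-≢ a≢b = a≢b ∘ Finₚ.suc-injective

  Pair-suc : Pair (s ∘ fsuc) (f ∘ fsuc) → Pair s f
  Pair-suc (pair i≢j si sj fij) = pair (fsuc-≢ i≢j) si sj fij

  Triple-suc : Triple (s ∘ fsuc) (f ∘ fsuc) → Triple s f
  Triple-suc (triple i≢j i≢l j≢l si sj sl fij fil) =
    triple (fsuc-≢ i≢j) (fsuc-≢ i≢l) (fsuc-≢ j≢l) si sj sl fij fil

  TwoPairs-suc : TwoPairs (s ∘ fsuc) (f ∘ fsuc) → TwoPairs s f
  TwoPairs-suc (twoPairs i≢j i≢l i≢o j≢l j≢o l≢o si sj sl so fij flo) =
    twoPairs (fsuc-≢ i≢j) (fsuc-≢ i≢l) (fsuc-≢ i≢o) (fsuc-≢ j≢l) (fsuc-≢ j≢o) (fsuc-≢ l≢o) si sj sl so fij flo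

module _ {K : ℕ} {s : Fin (suc K) → Bool} {f : Fin (suc K) → ℕ} {m : ℕ} where

  private
    s′ = s ∘ fsuc
    f′ = f ∘ fsuc

    oddDegree-head : ∀ {b} → s fzero ≡ b →
      oddDegree s f m ≡ countFin {m} (λ c → oddB (bit (b ∧ (f fzero ≡ᵇ toℕ c)) + multiplicity s′ f′ (toℕ c)))
    oddDegree-head s₀ =
      countFin-cong {m} (λ c → cong (λ b → oddB (bit (b ∧ (f fzero ≡ᵇ toℕ c)) + multiplicity s′ f′ (toℕ c))) s₀)

    countFin-head : ∀ {b} → s fzero ≡ b → countFin s ≡ bit b + countFin s′
    countFin-head s₀ = cong (λ b → bit b + countFin s′) s₀

  DegreeView-skip : s fzero ≡ false → DegreeView s′ f′ m → DegreeView s f m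
  DegreeView-skip s₀ (hasTriple t) = hasTriple (Triple-suc t)
  DegreeView-skip s₀ (hasTwoPairs t) = hasTwoPairs (TwoPairs-suc t)
  DegreeView-skip s₀ (noPair e) = noPair (trans (oddDegree-head s₀) (trans e (sym (countFin-head s₀))))
  DegreeView-skip s₀ (onePair p e) =
    onePair (Pair-suc p) (trans (cong (_+ 2) (oddDegree-head s₀)) (trans e (sym (countFin-head s₀))))

  module _ (s₀ : s fzero ≡ true) (f₀<m : f fzero < m) where

    private
      t = multiplicity s′ f′ (f fzero)
      D = oddDegree s f m
      D′ = oddDegree s′ f′ m

      count≡ : countFin s ≡ suc (countFin s′)
      count≡ = countFin-head s₀

      parity-flip : ∀ {u} → t ≡ u → D + bit (oddB u) ≡ D′ + bit (not (oddB u))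
      parity-flip refl = trans (cong (_+ bit (oddB t)) (oddDegree-head s₀))
                               (countFin-oddB-bump m (f fzero) (multiplicity s′ f′) f₀<m)

      D≡1+D′ : t ≡ 0 → D ≡ suc D′
      D≡1+D′ t≡0 = trans (sym (+-identityʳ D)) (trans (parity-flip t≡0) (+-comm D′ 1))

      1+D≡D′ : t ≡ 1 → suc D ≡ D′
      1+D≡D′ t≡1 = trans (+-comm 1 D) (trans (parity-flip t≡1) (+-identityʳ D′))

      atf₀ : Fin K → Bool
      atf₀ i = s′ i ∧ (f′ i ≡ᵇ f fzero)

    DegreeView-first : t ≡ 0 → DegreeView s′ f′ m → DegreeView s f m
    DegreeView-first t≡0 (noPair e) = noPair (trans (D≡1+D′ t≡0) (trans (cong suc e) (sym count≡)))
    DegreeView-first t≡0 (onePair p e) =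
      onePair (Pair-suc p) (trans (cong (_+ 2) (D≡1+D′ t≡0)) (trans (cong suc e) (sym count≡)))
    DegreeView-first _ (hasTriple t) = hasTriple (Triple-suc t)
    DegreeView-first _ (hasTwoPairs t) = hasTwoPairs (TwoPairs-suc t)

    DegreeView-second : t ≡ 1 → DegreeView s′ f′ m → DegreeView s f m
    DegreeView-second t≡1 view with countFin-≥1 atf₀ (≤-reflexive (sym t≡1))
    ... | j , atⱼ with ∧-true {s′ j} atⱼ
    ...   | sⱼ , fⱼ≡f₀ = pair-up view
      where
      f₀≡fⱼ : f fzero ≡ f′ j
      f₀≡fⱼ = sym (≡ᵇ-≡ fⱼ≡f₀)
      pair-up : DegreeView s′ f′ m → DegreeView s f m
      pair-up (noPair e) =
        onePair (pair (λ ()) s₀ sⱼ f₀≡fⱼ) (trans (+-comm D 2) (trans (cong suc (trans (1+D≡D′ t≡1) e)) (sym count≡)))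
      pair-up (onePair (pair {a} {b} a≢b sₐ s_b fab) e) with j Finₚ.≟ a | j Finₚ.≟ b
      ... | yes refl | _ =
        hasTriple (triple (λ ()) (λ ()) (a≢b ∘ Finₚ.suc-injective) s₀ sₐ s_b f₀≡fⱼ (trans f₀≡fⱼ fab))
      ... | no _ | yes refl =
        hasTriple (triple (λ ()) (λ ()) ((a≢b ∘ sym) ∘ Finₚ.suc-injective) s₀ s_b sₐ f₀≡fⱼ (trans f₀≡fⱼ (sym fab)))
      ... | no j≢a | no j≢b =
        hasTwoPairs (twoPairs (λ ()) (λ ()) (λ ()) (j≢a ∘ Finₚ.suc-injective) (j≢b ∘ Finₚ.suc-injective)
                              (a≢b ∘ Finₚ.suc-injective) s₀ sⱼ sₐ s_b f₀≡fⱼ fab)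
      pair-up (hasTriple t) = hasTriple (Triple-suc t)
      pair-up (hasTwoPairs t) = hasTwoPairs (TwoPairs-suc t)

    Triple-third : 2 ≤ t → Triple s f
    Triple-third 2≤t with countFin-≥2 atf₀ 2≤t
    ... | a , b , a≢b , atₐ , at_b =
      triple (λ ()) (λ ()) (a≢b ∘ Finₚ.suc-injective) s₀ (proj₁ (∧-true atₐ)) (proj₁ (∧-true at_b))
             (sym (≡ᵇ-≡ (proj₂ (∧-true {s′ a} atₐ)))) (sym (≡ᵇ-≡ (proj₂ (∧-true {s′ b} at_b))))

-- Add the sockets one at a time: a new socket joining c₀ changes the parity at c₀ only,
-- and a second or third socket at the same c₀ produces a pair or a triple.
degreeView : ∀ {K} (s : Fin K → Bool) (f : Fin K → ℕ) m → (∀ i → s i ≡ true → f i < m) → DegreeView s f m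
degreeView {zero} s f m _ = noPair (countFin-false m)
degreeView {suc K} s f m f<m with s fzero in s₀ | degreeView (s ∘ fsuc) (f ∘ fsuc) m (f<m ∘ fsuc)
... | false | view = DegreeView-skip s₀ view
... | true | view with multiplicity (s ∘ fsuc) (f ∘ fsuc) (f fzero) in t≡
...   | zero = DegreeView-first s₀ (f<m fzero s₀) t≡ view
...   | suc zero = DegreeView-second s₀ (f<m fzero s₀) t≡ view
...   | suc (suc _) = hasTriple (Triple-third s₀ (f<m fzero s₀) (≤-trans (s≤s (s≤s z≤n)) (≤-reflexive (sym t≡))))

irregular⇒Triple⊎TwoPairs : ∀ {K} {s : Fin K → Bool} {f : Fin K → ℕ} {m} d → countFin s ≡ d → DegreeView s f m →
  ((oddDegree s f m ≡ᵇ d) ∨ (oddDegree s f m ≡ᵇ d ∸ 2)) ≡ false → Triple s f ⊎ TwoPairs s f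
irregular⇒Triple⊎TwoPairs d count≡d (hasTriple t) _ = inj₁ t
irregular⇒Triple⊎TwoPairs d count≡d (hasTwoPairs t) _ = inj₂ t
irregular⇒Triple⊎TwoPairs d count≡d (noPair D≡count) irregular
  with () ← trans (sym (≡ᵇ-either (inj₁ (trans D≡count count≡d)))) irregular
irregular⇒Triple⊎TwoPairs {s = s} {f} {m} d count≡d (onePair _ D+2≡count) irregular
  with () ← trans (sym (≡ᵇ-either (inj₂ (trans (sym (m+n∸n≡m (oddDegree s f m) 2))
                                                (cong (_∸ 2) (trans D+2≡count count≡d)))))) irregular

∑<-block : ∀ d .{{_ : NonZero d}} q v → v < q → ∑< (q * d) (λ y → bit (y / d ≡ᵇ v)) ≡ d
∑<-block d (suc q) v (s≤s v≤q) = begin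
  ∑< (d + q * d) (λ y → bit (y / d ≡ᵇ v))
    ≡⟨ ∑<-+ d (q * d) _ ⟩
  ∑< d (λ y → bit (y / d ≡ᵇ v)) + ∑< (q * d) (λ y → bit ((d + y) / d ≡ᵇ v))
    ≡⟨ cong₂ _+_ (∑<-cong d (λ y y<d → cong (λ z → bit (z ≡ᵇ v)) (m<n⇒m/n≡0 y<d)))
                 (∑<-cong (q * d) (λ y _ → cong (λ z → bit (z ≡ᵇ v)) [d+y]/d≡1+y/d)) ⟩
  ∑< d (λ _ → bit (0 ≡ᵇ v)) + ∑< (q * d) (λ y → bit (suc (y / d) ≡ᵇ v))
    ≡⟨ first-block v v≤q ⟩
  d ∎
  where
  open ≡-Reasoning
  [d+y]/d≡1+y/d : ∀ {y} → (d + y) / d ≡ suc (y / d)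
  [d+y]/d≡1+y/d {y} = trans (m/n≡1+[m∸n]/n (m≤m+n d y)) (cong (λ z → suc (z / d)) (m+n∸m≡n d y))
  first-block : ∀ v → v ≤ q → ∑< d (λ _ → bit (0 ≡ᵇ v)) + ∑< (q * d) (λ y → bit (suc (y / d) ≡ᵇ v)) ≡ d
  first-block zero _ = trans (cong₂ _+_ (trans (∑<-const d 1) (*-identityʳ d)) (∑<-zero (q * d))) (+-identityʳ d)
  first-block (suc v) v<q =
    trans (cong (_+ ∑< (q * d) (λ y → bit (suc (y / d) ≡ᵇ suc v))) (∑<-zero d)) (∑<-block d q v v<q)

firstSocket : (d : ℕ) .{{_ : NonZero d}} → ℕ → ℕ
firstSocket d x = x / d * d

block+offset : ∀ d .{{_ : NonZero d}} {x y} → x / d ≡ y / d → firstSocket d x + y % d ≡ y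
block+offset d {x} {y} e = trans (cong (λ z → z * d + y % d) e) (trans (+-comm _ (y % d)) (sym (m≡m%n+[m/n]*n y d)))

module Sockets (dv dc n m : ℕ) .{{_ : NonZero dv}} .{{_ : NonZero dc}} where

  M : ℕ
  M = n * dv

  Wiring : Set
  Wiring = Vec (Fin M) M

  open KeyedVectors {Fin M} toℕ

  socketEdge : Wiring → Fin M → ℕ × ℕ
  socketEdge π i = toℕ i , toℕ (lookup π i)

  -- Invalid prescriptions, e.g. ones repeating a position, are discarded: (M - r)! need not bound their count.
  hits : Prescription → Wiring → ℕ
  hits W π = bit (does (valid? M W) ∧ satisfies W π)

  edges-valid : ∀ π is → Unique is → Valid M (map (socketEdge π) is)
  edges-valid π is unique =
    subst (All (_< M)) (map-∘ is) (Allₚ.map⁺ (All.universal Finₚ.toℕ<n is)) ,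
    subst Unique (map-∘ is) (Uniqueₚ.map⁺ Finₚ.toℕ-injective unique)

  satisfies-edges : ∀ π is → satisfies (map (socketEdge π) is) π ≡ true
  satisfies-edges π [] = refl
  satisfies-edges π (i ∷ is) rewrite hasKeyAt-lookup π i = satisfies-edges π is

  hits-edges : ∀ π is → Unique is → hits (map (socketEdge π) is) π ≡ 1
  hits-edges π is unique
    rewrite dec-true (valid? M (map (socketEdge π) is)) (edges-valid π is unique) = cong bit (satisfies-edges π is)

  1≤∑□-hits : ∀ {r} (Ks : Vec ℕ r) (W : Vec ℕ r → Prescription) π {idx} is →
    Pointwise _<_ idx Ks → W idx ≡ map (socketEdge π) is → Unique is → 1 ≤ ∑□ Ks (λ idx → hits (W idx) π)
  1≤∑□-hits Ks W π is idx<Ks W≡ unique =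
    ≤-trans (≤-reflexive (sym (trans (cong (λ W′ → hits W′ π) W≡) (hits-edges π is unique))))
            (term≤∑□ Ks (λ idx → hits (W idx) π) idx<Ks)

  sumMap-hits : ∀ W → sumMap (hits W) (perms (allFin M)) ≤ (M ∸ length W) !
  sumMap-hits W = begin
    sumMap (hits W) (perms (allFin M))
      ≡⟨ sumMap-bit _ (perms (allFin M)) ⟩
    countList (λ π → does (valid? M W) ∧ satisfies W π) (perms (allFin M))
      ≡⟨ countList-∧ˡ (does (valid? M W)) (satisfies W) (perms (allFin M)) ⟩
    bit (does (valid? M W)) * countList (satisfies W) (perms (allFin M))
      ≤⟨ bound (valid? M W) ⟩
    (M ∸ length W) ! ∎
    where
    open ≤-Reasoning
    bound : (v? : _) → bit (does v?) * countList (satisfies W) (perms (allFin M)) ≤ (M ∸ length W) !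
    bound (yes valid) = ≤-trans (≤-reflexive (*-identityˡ _))
                                (countList-satisfies (allFin M) (Distinct-tabulate id Finₚ.toℕ-injective) W valid)
    bound (no _) = z≤n

  tripleDims : Vec ℕ 6
  tripleDims = M ∷ dv ∷ dv ∷ M ∷ dc ∷ dc ∷ []

  -- Socket x and two further sockets of its variable, joined to sockets of the check of u = π x;
  -- the entries β, γ, ω, ψ are offsets inside the two blocks of sockets.
  sharedTriple : Vec ℕ 6 → Prescription
  sharedTriple (x ∷ β ∷ γ ∷ u ∷ ω ∷ ψ ∷ []) =
    (x , u) ∷ (firstSocket dv x + β , firstSocket dc u + ω) ∷ (firstSocket dv x + γ , firstSocket dc u + ψ) ∷ []

  pairsAtVariableDims : Vec ℕ 8
  pairsAtVariableDims = M ∷ dv ∷ dv ∷ dv ∷ M ∷ dc ∷ M ∷ dc ∷ []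

  pairsAtVariable : Vec ℕ 8 → Prescription
  pairsAtVariable (x ∷ β ∷ γ ∷ δ ∷ u ∷ ω ∷ y ∷ ζ ∷ []) =
    (x , u) ∷ (firstSocket dv x + β , firstSocket dc u + ω) ∷
    (firstSocket dv x + γ , y) ∷ (firstSocket dv x + δ , firstSocket dc y + ζ) ∷ []

  pairsAtCheckDims : Vec ℕ 8
  pairsAtCheckDims = M ∷ dv ∷ M ∷ dv ∷ M ∷ dc ∷ dc ∷ dc ∷ []

  pairsAtCheck : Vec ℕ 8 → Prescription
  pairsAtCheck (x ∷ β ∷ z ∷ δ ∷ u ∷ ω ∷ ψ ∷ ζ ∷ []) =
    (x , u) ∷ (firstSocket dv x + β , firstSocket dc u + ω) ∷
    (z , firstSocket dc u + ψ) ∷ (firstSocket dv z + δ , firstSocket dc u + ζ) ∷ []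

  tripleHits pairsAtVariableHits pairsAtCheckHits collisions : Wiring → ℕ
  tripleHits π = ∑□ tripleDims (λ is → hits (sharedTriple is) π)
  pairsAtVariableHits π = ∑□ pairsAtVariableDims (λ is → hits (pairsAtVariable is) π)
  pairsAtCheckHits π = ∑□ pairsAtCheckDims (λ is → hits (pairsAtCheck is) π)
  collisions π = tripleHits π + pairsAtVariableHits π + pairsAtCheckHits π

  module _ (π : Wiring) where

    variableOf checkOf : Fin M → ℕ
    variableOf i = toℕ i / dv
    checkOf i = toℕ (lookup π i) / dc

    private
      val : Fin M → ℕ
      val i = toℕ (lookup π i)
      val<M : ∀ i → val i < M
      val<M i = Finₚ.toℕ<n (lookup π i)

    sharedTriple-hit : ∀ {i j l} → i ≢ j → i ≢ l → j ≢ l →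
      variableOf i ≡ variableOf j → variableOf i ≡ variableOf l →
      checkOf i ≡ checkOf j → checkOf i ≡ checkOf l →
      1 ≤ tripleHits π
    sharedTriple-hit {i} {j} {l} i≢j i≢l j≢l vᵢⱼ vᵢₗ cᵢⱼ cᵢₗ =
      1≤∑□-hits tripleDims sharedTriple π (i ∷ j ∷ l ∷ [])
        (Finₚ.toℕ<n i ∷ m%n<n (toℕ j) dv ∷ m%n<n (toℕ l) dv ∷
         val<M i ∷ m%n<n (val j) dc ∷ m%n<n (val l) dc ∷ [])
        W≡ ((i≢j ∷ i≢l ∷ []) ∷ (j≢l ∷ []) ∷ [] ∷ [])
      where
      W≡ : sharedTriple (toℕ i ∷ toℕ j % dv ∷ toℕ l % dv ∷ val i ∷ val j % dc ∷ val l % dc ∷ [])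
           ≡ map (socketEdge π) (i ∷ j ∷ l ∷ [])
      W≡ rewrite block+offset dv vᵢⱼ | block+offset dv vᵢₗ
               | block+offset dc cᵢⱼ | block+offset dc cᵢₗ = refl

    pairsAtVariable-hit : ∀ {i j l o} → i ≢ j → i ≢ l → i ≢ o → j ≢ l → j ≢ o → l ≢ o →
      variableOf i ≡ variableOf j → variableOf i ≡ variableOf l → variableOf i ≡ variableOf o →
      checkOf i ≡ checkOf j → checkOf l ≡ checkOf o →
      1 ≤ pairsAtVariableHits π
    pairsAtVariable-hit {i} {j} {l} {o} i≢j i≢l i≢o j≢l j≢o l≢o vᵢⱼ vᵢₗ vᵢₒ cᵢⱼ cₗₒ =
      1≤∑□-hits pairsAtVariableDims pairsAtVariable π (i ∷ j ∷ l ∷ o ∷ [])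
        (Finₚ.toℕ<n i ∷ m%n<n (toℕ j) dv ∷ m%n<n (toℕ l) dv ∷ m%n<n (toℕ o) dv ∷
         val<M i ∷ m%n<n (val j) dc ∷ val<M l ∷ m%n<n (val o) dc ∷ [])
        W≡ ((i≢j ∷ i≢l ∷ i≢o ∷ []) ∷ (j≢l ∷ j≢o ∷ []) ∷ (l≢o ∷ []) ∷ [] ∷ [])
      where
      W≡ : pairsAtVariable (toℕ i ∷ toℕ j % dv ∷ toℕ l % dv ∷ toℕ o % dv ∷
                            val i ∷ val j % dc ∷ val l ∷ val o % dc ∷ [])
           ≡ map (socketEdge π) (i ∷ j ∷ l ∷ o ∷ [])
      W≡ rewrite block+offset dv vᵢⱼ | block+offset dv vᵢₗ | block+offset dv vᵢₒ
               | block+offset dc cᵢⱼ | block+offset dc cₗₒ = refl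

    pairsAtCheck-hit : ∀ {i j l o} → i ≢ j → i ≢ l → i ≢ o → j ≢ l → j ≢ o → l ≢ o →
      variableOf i ≡ variableOf j → variableOf l ≡ variableOf o →
      checkOf i ≡ checkOf j → checkOf i ≡ checkOf l → checkOf i ≡ checkOf o →
      1 ≤ pairsAtCheckHits π
    pairsAtCheck-hit {i} {j} {l} {o} i≢j i≢l i≢o j≢l j≢o l≢o vᵢⱼ vₗₒ cᵢⱼ cᵢₗ cᵢₒ =
      1≤∑□-hits pairsAtCheckDims pairsAtCheck π (i ∷ j ∷ l ∷ o ∷ [])
        (Finₚ.toℕ<n i ∷ m%n<n (toℕ j) dv ∷ Finₚ.toℕ<n l ∷ m%n<n (toℕ o) dv ∷
         val<M i ∷ m%n<n (val j) dc ∷ m%n<n (val l) dc ∷ m%n<n (val o) dc ∷ [])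
        W≡ ((i≢j ∷ i≢l ∷ i≢o ∷ []) ∷ (j≢l ∷ j≢o ∷ []) ∷ (l≢o ∷ []) ∷ [] ∷ [])
      where
      W≡ : pairsAtCheck (toℕ i ∷ toℕ j % dv ∷ toℕ l ∷ toℕ o % dv ∷
                         val i ∷ val j % dc ∷ val l % dc ∷ val o % dc ∷ [])
           ≡ map (socketEdge π) (i ∷ j ∷ l ∷ o ∷ [])
      W≡ rewrite block+offset dv vᵢⱼ | block+offset dv vₗₒ
               | block+offset dc cᵢⱼ | block+offset dc cᵢₗ | block+offset dc cᵢₒ = refl

  open LDPC dv dc

  ColumnsFull : Wiring → Set
  ColumnsFull π = ∀ c → c < m → countFin (λ i → checkOf π i ≡ᵇ c) ≡ dc

  module _ (n*dv≡m*dc : n * dv ≡ m * dc) where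

    columnsFull : All ColumnsFull (perms (allFin M))
    columnsFull = All.map (λ {π} same c c<m → begin
        countFin (g c ∘ lookup π)             ≡⟨ same (g c) ⟩
        countFin (g c ∘ lookup (allFin M))    ≡⟨ countFin-lookup-allFin M (g c) ⟩
        countFin (g c)                        ≡⟨ countFin-∑< M (λ y → y / dc ≡ᵇ c) ⟩
        ∑< M (λ y → bit (y / dc ≡ᵇ c))        ≡⟨ cong (λ K → ∑< K (λ y → bit (y / dc ≡ᵇ c))) n*dv≡m*dc ⟩
        ∑< (m * dc) (λ y → bit (y / dc ≡ᵇ c)) ≡⟨ ∑<-block dc m c c<m ⟩
        dc ∎)
      (countFin-lookup-perms (allFin M))
      where
      open ≡-Reasoning
      g : ℕ → Fin M → Bool
      g c y = toℕ y / dc ≡ᵇ c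

    irregularVariable⇒collision : ∀ π (v : Fin n) →
      ((degVar m π v ≡ᵇ dv) ∨ (degVar m π v ≡ᵇ dv ∸ 2)) ≡ false → 1 ≤ collisions π
    irregularVariable⇒collision π v irregular
      with irregular⇒Triple⊎TwoPairs dv sockets (degreeView sel (checkOf π) m (λ i _ → check<m i)) irregular
      where
      sel : Fin M → Bool
      sel i = variableOf π i ≡ᵇ toℕ v
      sockets : countFin sel ≡ dv
      sockets = trans (countFin-∑< M (λ y → y / dv ≡ᵇ toℕ v)) (∑<-block dv n (toℕ v) (Finₚ.toℕ<n v))
      check<m : ∀ i → checkOf π i < m
      check<m i = m<n*o⇒m/o<n (subst (toℕ (lookup π i) <_) n*dv≡m*dc (Finₚ.toℕ<n (lookup π i)))
    ... | inj₁ (triple i≢j i≢l j≢l sᵢ sⱼ sₗ cᵢⱼ cᵢₗ) =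
      ≤-trans (sharedTriple-hit π i≢j i≢l j≢l (≡ᵇ-same sᵢ sⱼ) (≡ᵇ-same sᵢ sₗ) cᵢⱼ cᵢₗ)
              (≤-trans (m≤m+n (tripleHits π) _) (m≤m+n _ (pairsAtCheckHits π)))
    ... | inj₂ (twoPairs i≢j i≢l i≢o j≢l j≢o l≢o sᵢ sⱼ sₗ sₒ cᵢⱼ cₗₒ) =
      ≤-trans (pairsAtVariable-hit π i≢j i≢l i≢o j≢l j≢o l≢o
                 (≡ᵇ-same sᵢ sⱼ) (≡ᵇ-same sᵢ sₗ) (≡ᵇ-same sᵢ sₒ) cᵢⱼ cₗₒ)
              (≤-trans (m≤n+m (pairsAtVariableHits π) (tripleHits π)) (m≤m+n _ (pairsAtCheckHits π)))

    irregularCheck⇒collision : ∀ π → ColumnsFull π → (c : Fin m) →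
      ((degChk n π c ≡ᵇ dc) ∨ (degChk n π c ≡ᵇ dc ∸ 2)) ≡ false → 1 ≤ collisions π
    irregularCheck⇒collision π full c irregular
      with irregular⇒Triple⊎TwoPairs dc (full (toℕ c) (Finₚ.toℕ<n c))
             (degreeView sel (variableOf π) n (λ i _ → m<n*o⇒m/o<n (Finₚ.toℕ<n i)))
             (subst (λ D → ((D ≡ᵇ dc) ∨ (D ≡ᵇ dc ∸ 2)) ≡ false) degChk≡ irregular)
      where
      sel : Fin M → Bool
      sel i = checkOf π i ≡ᵇ toℕ c
      degChk≡ : degChk n π c ≡ oddDegree sel (variableOf π) n
      degChk≡ = countFin-cong {n} (λ v →
        cong oddB (countFin-cong {M} (λ i → ∧-comm (variableOf π i ≡ᵇ toℕ v) (sel i))))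
    ... | inj₁ (triple i≢j i≢l j≢l sᵢ sⱼ sₗ vᵢⱼ vᵢₗ) =
      ≤-trans (sharedTriple-hit π i≢j i≢l j≢l vᵢⱼ vᵢₗ (≡ᵇ-same sᵢ sⱼ) (≡ᵇ-same sᵢ sₗ))
              (≤-trans (m≤m+n (tripleHits π) _) (m≤m+n _ (pairsAtCheckHits π)))
    ... | inj₂ (twoPairs i≢j i≢l i≢o j≢l j≢o l≢o sᵢ sⱼ sₗ sₒ vᵢⱼ vₗₒ) =
      ≤-trans (pairsAtCheck-hit π i≢j i≢l i≢o j≢l j≢o l≢o
                 vᵢⱼ vₗₒ (≡ᵇ-same sᵢ sⱼ) (≡ᵇ-same sᵢ sₗ) (≡ᵇ-same sᵢ sₒ))
              (m≤n+m (pairsAtCheckHits π) _)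

    irregular⇒collision : ∀ π → ColumnsFull π → good n m π ≡ false → 1 ≤ collisions π
    irregular⇒collision π full bad
      with ∧-false {allFinB {n} (λ v → (degVar m π v ≡ᵇ dv) ∨ (degVar m π v ≡ᵇ dv ∸ 2))} bad
    ... | inj₁ badVariable with allFinB-false _ badVariable
    ...   | v , irregular = irregularVariable⇒collision π v irregular
    irregular⇒collision π full bad | inj₂ badCheck with allFinB-false _ badCheck
    ...   | c , irregular = irregularCheck⇒collision π full c irregular

  sumMap-∑□-hits : ∀ {r} (Ks : Vec ℕ r) (W : Vec ℕ r → Prescription) ℓ → (∀ is → length (W is) ≡ ℓ) →
    sumMap (λ π → ∑□ Ks (λ is → hits (W is) π)) (perms (allFin M)) ≤ ∏ Ks * (M ∸ ℓ) !
  sumMap-∑□-hits Ks W ℓ length≡ℓ =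
    ≤-trans (≤-reflexive (sumMap-∑□ Ks (λ π is → hits (W is) π) (perms (allFin M))))
            (∑□-bound Ks (λ is → subst (λ ℓ′ → _ ≤ (M ∸ ℓ′) !) (length≡ℓ is) (sumMap-hits (W is))))

  badCount≤ : n * dv ≡ m * dc →
    badCount n m ≤ ∏ tripleDims * (M ∸ 3) ! + ∏ pairsAtVariableDims * (M ∸ 4) ! + ∏ pairsAtCheckDims * (M ∸ 4) !
  badCount≤ n*dv≡m*dc = begin
    countList (λ π → not (good n m π)) Π
      ≤⟨ countList≤sumMap _ collisions (columnsFull n*dv≡m*dc) (λ {π} → bad≤collisions π) ⟩
    sumMap collisions Π
      ≡⟨ trans (sumMap-distrib-+ (λ π → tripleHits π + pairsAtVariableHits π) pairsAtCheckHits Π)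
               (cong (_+ sumMap pairsAtCheckHits Π) (sumMap-distrib-+ tripleHits pairsAtVariableHits Π)) ⟩
    sumMap tripleHits Π + sumMap pairsAtVariableHits Π + sumMap pairsAtCheckHits Π
      ≤⟨ +-mono-≤ (+-mono-≤ (sumMap-∑□-hits tripleDims sharedTriple 3 λ { (_ ∷ _ ∷ _ ∷ _ ∷ _ ∷ _ ∷ []) → refl })
                            (sumMap-∑□-hits pairsAtVariableDims pairsAtVariable 4
                               λ { (_ ∷ _ ∷ _ ∷ _ ∷ _ ∷ _ ∷ _ ∷ _ ∷ []) → refl }))
                  (sumMap-∑□-hits pairsAtCheckDims pairsAtCheck 4 λ { (_ ∷ _ ∷ _ ∷ _ ∷ _ ∷ _ ∷ _ ∷ _ ∷ []) → refl }) ⟩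
    ∏ tripleDims * (M ∸ 3) ! + ∏ pairsAtVariableDims * (M ∸ 4) ! + ∏ pairsAtCheckDims * (M ∸ 4) ! ∎
    where
    open ≤-Reasoning
    Π = perms (allFin M)
    bad≤collisions : ∀ π → ColumnsFull π → bit (not (good n m π)) ≤ collisions π
    bad≤collisions π full with good n m π in good≡
    ... | true = z≤n
    ... | false = irregular⇒collision n*dv≡m*dc π full good≡

cube≤8*[M∸1][M∸2][M∸3] : ∀ t → 2 ≤ t → (4 + t) * (4 + t) * (4 + t) ≤ 8 * ((3 + t) * ((2 + t) * (1 + t)))
cube≤8*[M∸1][M∸2][M∸3] t 2≤t = begin
  (4 + t) * (4 + t) * (4 + t)                   ≤⟨ *-mono-≤ (*-mono-≤ M≤2[1+t] M≤2[1+t]) M≤2[1+t] ⟩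
  (2 * (1 + t)) * (2 * (1 + t)) * (2 * (1 + t)) ≡⟨ cube-of-double t ⟩
  8 * ((1 + t) * ((1 + t) * (1 + t)))           ≤⟨ *-monoʳ-≤ 8 (*-mono-≤ (m≤n+m (1 + t) 2)
                                                                         (*-monoˡ-≤ (1 + t) (m≤n+m (1 + t) 1))) ⟩
  8 * ((3 + t) * ((2 + t) * (1 + t)))           ∎
  where
  open ≤-Reasoning
  cube-of-double : ∀ t → (2 * (1 + t)) * (2 * (1 + t)) * (2 * (1 + t)) ≡ 8 * ((1 + t) * ((1 + t) * (1 + t)))
  cube-of-double = solve-∀
  double : ∀ t → 2 + (t + t) ≡ 2 * (1 + t)
  double = solve-∀
  M≤2[1+t] : 4 + t ≤ 2 * (1 + t)
  M≤2[1+t] = ≤-trans (+-monoʳ-≤ 2 (+-monoˡ-≤ t 2≤t)) (≤-reflexive (double t))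

Q*M³*[M∸4]!≤M! : ∀ Q t → 2 ≤ t → 8 * Q ≤ 4 + t → Q * ((4 + t) * (4 + t) * (4 + t)) * t ! ≤ (4 + t) !
Q*M³*[M∸4]!≤M! Q t 2≤t 8Q≤M = begin
  Q * M³ * t !      ≤⟨ *-monoˡ-≤ (t !) (*-cancelˡ-≤ {Q * M³} 8 8QM³≤8MP) ⟩
  (4 + t) * P * t ! ≡⟨ factorial (4 + t) t (t !) ⟩
  (4 + t) !         ∎
  where
  open ≤-Reasoning
  M³ = (4 + t) * (4 + t) * (4 + t)
  P = (3 + t) * ((2 + t) * (1 + t))
  8QM³≤8MP : 8 * (Q * M³) ≤ 8 * ((4 + t) * P)
  8QM³≤8MP = begin
    8 * (Q * M³)     ≡⟨ sym (*-assoc 8 Q M³) ⟩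
    8 * Q * M³       ≤⟨ *-monoˡ-≤ M³ 8Q≤M ⟩
    (4 + t) * M³     ≤⟨ *-monoʳ-≤ (4 + t) (cube≤8*[M∸1][M∸2][M∸3] t 2≤t) ⟩
    (4 + t) * (8 * P) ≡⟨ x*[y*z]≡y*[x*z] (4 + t) 8 P ⟩
    8 * ((4 + t) * P) ∎
  factorial : ∀ M t F → M * ((3 + t) * ((2 + t) * (1 + t))) * F ≡ M * ((3 + t) * ((2 + t) * ((1 + t) * F)))
  factorial = solve-∀

module _ (dv dc : ℕ) .{{_ : NonZero dv}} .{{_ : NonZero dc}} where

  collisionWeight : ℕ
  collisionWeight = (dv * dc) * (dv * dc) * (dv * dc)

  collisionTerms≤ : ∀ t → let M = 4 + t in
      ∏ (M ∷ dv ∷ dv ∷ M ∷ dc ∷ dc ∷ []) * (M ∸ 3) !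
    + ∏ (M ∷ dv ∷ dv ∷ dv ∷ M ∷ dc ∷ M ∷ dc ∷ []) * (M ∸ 4) !
    + ∏ (M ∷ dv ∷ M ∷ dv ∷ M ∷ dc ∷ dc ∷ dc ∷ []) * (M ∸ 4) !
    ≤ 3 * collisionWeight * (M * M * M) * t !
  collisionTerms≤ t = ≤-trans (+-mono-≤ (+-mono-≤ T₁≤X T₂≤X) T₃≤X) (≤-reflexive (three-X M³ collisionWeight (t !)))
    where
    M = 4 + t
    D = dv * dc
    M³ = M * M * M
    X = M³ * collisionWeight * t !
    three-X : ∀ M³ C F → M³ * C * F + M³ * C * F + M³ * C * F ≡ 3 * C * M³ * F
    three-X = solve-∀
    T₁≤X : ∏ (M ∷ dv ∷ dv ∷ M ∷ dc ∷ dc ∷ []) * (1 + t) ! ≤ X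
    T₁≤X = ≤-trans (≤-reflexive (normalise M t dv dc (t !)))
                   (*-monoˡ-≤ (t !) (*-mono-≤ (*-monoʳ-≤ (M * M) (m≤n+m (1 + t) 3))
                                              (*-monoʳ-≤ (D * D) (>-nonZero⁻¹ D {{m*n≢0 dv dc}}))))
      where
      normalise : ∀ M t dv dc F → M * (dv * (dv * (M * (dc * (dc * 1))))) * ((1 + t) * F)
                                  ≡ (M * M * (1 + t)) * ((dv * dc) * (dv * dc) * 1) * F
      normalise = solve-∀
    T₂≤X : ∏ (M ∷ dv ∷ dv ∷ dv ∷ M ∷ dc ∷ M ∷ dc ∷ []) * t ! ≤ X
    T₂≤X = ≤-trans (≤-reflexive (normalise M dv dc (t !)))
                   (*-monoˡ-≤ (t !) (*-monoʳ-≤ M³ (*-monoʳ-≤ (D * D) (m≤m*n dv dc))))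
      where
      normalise : ∀ M dv dc F → M * (dv * (dv * (dv * (M * (dc * (M * (dc * 1))))))) * F
                                ≡ (M * M * M) * ((dv * dc) * (dv * dc) * dv) * F
      normalise = solve-∀
    T₃≤X : ∏ (M ∷ dv ∷ M ∷ dv ∷ M ∷ dc ∷ dc ∷ dc ∷ []) * t ! ≤ X
    T₃≤X = ≤-trans (≤-reflexive (normalise M dv dc (t !)))
                   (*-monoˡ-≤ (t !) (*-monoʳ-≤ M³ (*-monoʳ-≤ (D * D) (m≤n*m dc dv))))
      where
      normalise : ∀ M dv dc F → M * (dv * (M * (dv * (M * (dc * (dc * (dc * 1))))))) * F
                                ≡ (M * M * M) * ((dv * dc) * (dv * dc) * dc) * F
      normalise = solve-∀

  threshold : ℕ → ℕ
  threshold k = 8 * (3 * k * collisionWeight) + 6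

  collisionBound : ∀ k M → threshold k ≤ M →
    k * (∏ (M ∷ dv ∷ dv ∷ M ∷ dc ∷ dc ∷ []) * (M ∸ 3) !
       + ∏ (M ∷ dv ∷ dv ∷ dv ∷ M ∷ dc ∷ M ∷ dc ∷ []) * (M ∸ 4) !
       + ∏ (M ∷ dv ∷ M ∷ dv ∷ M ∷ dc ∷ dc ∷ dc ∷ []) * (M ∸ 4) !) ≤ M !
  collisionBound k M N≤M with ≤-trans (m≤n+m 6 (8 * (3 * k * collisionWeight))) N≤M
  ... | s≤s (s≤s (s≤s (s≤s {n = t} 2≤t))) = begin
    k * (T₁ + T₂ + T₃)                        ≤⟨ *-monoʳ-≤ k (collisionTerms≤ t) ⟩
    k * (3 * C * M³ * t !)                    ≡⟨ regroup k C M³ (t !) ⟩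
    3 * k * C * M³ * t !                      ≤⟨ Q*M³*[M∸4]!≤M! (3 * k * C) t 2≤t (≤-trans (m≤m+n _ 6) N≤M) ⟩
    M ! ∎
    where
    open ≤-Reasoning
    C = collisionWeight
    M³ = M * M * M
    T₁ = ∏ (M ∷ dv ∷ dv ∷ M ∷ dc ∷ dc ∷ []) * (M ∸ 3) !
    T₂ = ∏ (M ∷ dv ∷ dv ∷ dv ∷ M ∷ dc ∷ M ∷ dc ∷ []) * (M ∸ 4) !
    T₃ = ∏ (M ∷ dv ∷ M ∷ dv ∷ M ∷ dc ∷ dc ∷ dc ∷ []) * (M ∸ 4) !
    regroup : ∀ k C M³ F → k * (3 * C * M³ * F) ≡ 3 * k * C * M³ * F
    regroup = solve-∀

lemma2 : (dv dc : ℕ) .{{_ : NonZero dv}} .{{_ : NonZero dc}} → (k : ℕ) →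
    ∃[ N ] ((n m : ℕ) → N ≤ n → n * dv ≡ m * dc →
      k * LDPC.badCount dv dc n m ≤ (n * dv) !)
lemma2 dv dc k = threshold dv dc k , λ n m N≤n n*dv≡m*dc →
  ≤-trans (*-monoʳ-≤ k (Sockets.badCount≤ dv dc n m n*dv≡m*dc))
          (collisionBound dv dc k (n * dv) (≤-trans N≤n (m≤m*n n dv)))
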